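{- Let $D^{(s)}_{min}=\{x\in V:(x,\alpha)\ge-1\ (\alpha\in\Pi_s),\ (x,\alpha)\ge0\ (\alpha\in\Pi_l),\ (x,\theta)\le1\}$. (1) An element $w=v\cdot t_r\in\widehat W$ ($v\in W$, $r\in Q^\vee$) is $s$-minimal if and only if $w$ is dominant and $v(r)\in D^{(s)}_{min}\cap Q^\vee$. (2) The map from the set of $s$-minimal elements to $D^{(s)}_{min}\cap Q^\vee$, $w=v\cdot t_r\mapsto v(r)$, is a bijection.
   Context: Let $\Delta$ be an irreducible reduced crystallographic root system with two root lengths in a real Euclidean space $V$ with $W$-invariant inner product $(\cdot,\cdot)$; $W$ its Weyl group, $\Delta^+$ positive roots, $\Pi=\{\alpha_1,\dots,\alpha_p\}$ simple roots, $\Pi_s,\Pi_l$ the short/long simple roots, $\theta$ the highest root, $\mu^\vee=2\mu/(\mu,\mu)$, $Q^\vee=\bigoplus\mathbb Z\alpha_i^\vee$. Affine setting: $\widehat V=V\oplus\mathbb R\delta\oplus\mathbb R\lambda$ with $(\delta,V)=(\lambda,V)=(\delta,\delta)=(\lambda,\lambda)=0$, $(\delta,\lambda)=1$; affine roots $\mu+k\delta$, positive affine roots $\widehat\Delta^+=\Delta^+\cup\{\mu+k\delta:\mu\in\Delta,k\ge1\}$, $\widehat\Pi=\Pi\cup\{\alpha_0=\delta-\theta\}$, $\widehat\Pi_l=\Pi_l\cup\{\alpha_0\}$. $\widehat W$ is generated by the reflections of $\widehat V$ in $\widehat\Pi$; each $w$ is uniquely $w=v\cdot t_r$ with $v\in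 W$ (fixing $\delta$), $r\in Q^\vee$, $t_r(x)=x-(x,r)\delta$ on $V\oplus\mathbb R\delta$. $w$ is dominant if $w(\alpha)\in\widehat\Delta^+$ for all $\alpha\in\Pi$; $w$ is $s$-minimal if it is dominant and, writing $w^{ -1}(\alpha)=\mu+k\delta$ ($\mu\in\Delta$), $k\ge-1$ for all $\alpha\in\Pi_s$ and $k\ge0$ for all $\alpha\in\widehat\Pi_l$.
   Formalization: The space V is taken as ℚ^n with a W-invariant inner product taking rational values, rather than a real Euclidean space with a real inner product. -}

module Defs where

-- All data is rational, so the Euclidean space V is modelled as ℚ^n
-- (vectors Fin n → ℚ) carrying an arbitrary symmetric positive definite
-- bilinear form, given by its Gram matrix.

open import Data.Nat as ℕ using (ℕ; zero; suc)
open import Data.Integer as ℤ using (ℤ)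
open import Data.Rational
  using (ℚ; 0ℚ; 1ℚ; _+_; _*_; -_; _-_; _≤_; _<_; _÷_; _/_; ≢-nonZero)
open import Data.Rational.Properties using (_≟_)
open import Data.Fin using (Fin; zero; suc)
open import Data.List using (List; []; _∷_; foldr; reverse)
open import Data.List.Membership.Propositional using (_∈_)
open import Data.Product using (Σ; ∃; _×_; _,_; proj₁; proj₂)
open import Data.Sum using (_⊎_)
open import Data.Bool using (Bool; true; false)
open import Relation.Nullary using (¬_; yes; no)
open import Relation.Binary.PropositionalEquality using (_≡_; _≢_)

Vec : ℕ → Set
Vec n = Fin n → ℚ

∑ : ∀ {n} → (Fin n → ℚ) → ℚ
∑ {zero}  f = 0ℚ
∑ {suc n} f = f zero + ∑ (λ i → f (suc i))

module _ {n : ℕ} where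
  0v : Vec n
  0v _ = 0ℚ

  _+v_ : Vec n → Vec n → Vec n
  (x +v y) i = x i + y i

  _-v_ : Vec n → Vec n → Vec n
  (x -v y) i = x i - y i

  _·v_ : ℚ → Vec n → Vec n
  (c ·v x) i = c * x i

  _≗v_ : Vec n → Vec n → Set
  x ≗v y = ∀ i → x i ≡ y i

  lincomb : (Fin n → ℚ) → (Fin n → Vec n) → Vec n
  lincomb c v j = ∑ (λ i → c i * v i j)

ℤ→ℚ : ℤ → ℚ
ℤ→ℚ z = z / 1

ℕ→ℚ : ℕ → ℚ
ℕ→ℚ m = ℤ.+ m / 1

-- total division (value 0 when dividing by 0; only ever used with a
-- nonzero denominator (α,α) of a root α)
_/'_ : ℚ → ℚ → ℚ
p /' q with q ≟ 0ℚ
... | yes _ = 0ℚ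
... | no q≢0 = _÷_ p q {{≢-nonZero q≢0}}

2ℚ : ℚ
2ℚ = 1ℚ + 1ℚ

record RootSystem (n : ℕ) : Set where
  field
    gram      : Fin n → Fin n → ℚ
  ⟪_,_⟫ : Vec n → Vec n → ℚ
  ⟪ x , y ⟫ = ∑ (λ i → ∑ (λ j → x i * gram i j * y j))

  _ᵛ : Vec n → Vec n
  μ ᵛ = (2ℚ /' ⟪ μ , μ ⟫) ·v μ

  refl : Vec n → Vec n → Vec n
  refl μ x = x -v (⟪ x , μ ᵛ ⟫ ·v μ)

  field
    gram-sym    : ∀ i j → gram i j ≡ gram j i
    gram-posdef : ∀ (x : Vec n) → (∃ λ i → x i ≢ 0ℚ) → 0ℚ < ⟪ x , x ⟫
    roots       : List (Vec n)
    simple      : Fin n → Vec n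
  field
    roots-nonzero : ∀ α → α ∈ roots → ∃ λ i → α i ≢ 0ℚ
    roots-refl    : ∀ α β → α ∈ roots → β ∈ roots → refl α β ∈ roots
    roots-cryst   : ∀ α β → α ∈ roots → β ∈ roots →
                    ∃ λ (k : ℤ) → ⟪ β , α ᵛ ⟫ ≡ ℤ→ℚ k
    roots-reduced : ∀ α β (c : ℚ) → α ∈ roots → β ∈ roots →
                    β ≗v (c ·v α) → (c ≡ 1ℚ ⊎ c ≡ - 1ℚ)
    irreducible   : ∀ (P : Vec n → Bool) →
                    (∀ α β → α ∈ roots → β ∈ roots → P α ≡ true → P β ≡ false →
                       ⟪ α , β ⟫ ≡ 0ℚ) →
                    (∀ α → α ∈ roots → P α ≡ true) ⊎ (∀ α → α ∈ roots → P α ≡ false)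
    two-lengths   : ∃ λ α → ∃ λ β → α ∈ roots × β ∈ roots × ⟪ α , α ⟫ ≢ ⟪ β , β ⟫
    simple-roots  : ∀ i → simple i ∈ roots
    simple-indep  : ∀ (c : Fin n → ℚ) → lincomb c simple ≗v 0v → ∀ i → c i ≡ 0ℚ
    simple-base   : ∀ β → β ∈ roots → ∃ λ (c : Fin n → ℕ) →
                      (β ≗v lincomb (λ i → ℕ→ℚ (c i)) simple) ⊎
                      (β ≗v lincomb (λ i → - ℕ→ℚ (c i)) simple)

  IsPos : Vec n → Set
  IsPos β = β ∈ roots × ∃ λ (c : Fin n → ℕ) → β ≗v lincomb (λ i → ℕ→ℚ (c i)) simple

  IsHighest : Vec n → Set
  IsHighest θ = θ ∈ roots ×
    (∀ β → β ∈ roots → ∃ λ (c : Fin n → ℕ) → (θ -v β) ≗v lincomb (λ i → ℕ→ℚ (c i)) simple)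

  IsShort : Vec n → Set
  IsShort α = ∃ λ β → β ∈ roots × ⟪ α , α ⟫ < ⟪ β , β ⟫

  IsLong : Vec n → Set
  IsLong α = ∀ β → β ∈ roots → ⟪ β , β ⟫ ≤ ⟪ α , α ⟫

  InQᵛ : Vec n → Set
  InQᵛ x = ∃ λ (c : Fin n → ℤ) → x ≗v lincomb (λ i → ℤ→ℚ (c i)) (λ i → simple i ᵛ)

  InDmin : Vec n → Vec n → Set
  InDmin θ x = (∀ i → IsShort (simple i) → - 1ℚ ≤ ⟪ x , simple i ⟫)
             × (∀ i → IsLong (simple i) → 0ℚ ≤ ⟪ x , simple i ⟫)
             × ⟪ x , θ ⟫ ≤ 1ℚ

  -- Weyl group W: elements given by words in the simple reflections

  actW : List (Fin n) → Vec n → Vec n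
  actW word x = foldr (λ i y → refl (simple i) y) x word

  actW⁻¹ : List (Fin n) → Vec n → Vec n
  actW⁻¹ word = actW (reverse word)

  -- Affine setting.  Elements of V ⊕ ℚδ are pairs (x , k) = x + kδ.

  Vδ : Set
  Vδ = Vec n × ℚ

  IsPosAffine : Vδ → Set
  IsPosAffine (μ , k) = (IsPos μ × k ≡ 0ℚ)
                      ⊎ (μ ∈ roots × ∃ λ (m : ℕ) → k ≡ ℕ→ℚ (suc m))

  -- an element w = v · t_r of Ŵ, v ∈ W (as a word), r ∈ Q^∨ (coordinates
  -- with respect to the simple coroots)
  record Ŵ : Set where
    constructor _·t_
    field
      v    : List (Fin n)
      rco  : Fin n → ℤ
    r : Vec n
    r = lincomb (λ i → ℤ→ℚ (rco i)) (λ i → simple i ᵛ)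

  open Ŵ public

  tr : Vec n → Vδ → Vδ
  tr ρ (x , k) = x , (k - ⟪ x , ρ ⟫)

  vact : List (Fin n) → Vδ → Vδ
  vact word (x , k) = actW word x , k

  vact⁻¹ : List (Fin n) → Vδ → Vδ
  vact⁻¹ word (x , k) = actW⁻¹ word x , k

  actŴ : Ŵ → Vδ → Vδ
  actŴ w p = vact (v w) (tr (r w) p)

  actŴ⁻¹ : Ŵ → Vδ → Vδ
  actŴ⁻¹ w p = tr (0v -v r w) (vact⁻¹ (v w) p)

  _≈Ŵ_ : Ŵ → Ŵ → Set
  w ≈Ŵ w' = ∀ (p : Vδ) → (proj₁ (actŴ w p) ≗v proj₁ (actŴ w' p))
                        × proj₂ (actŴ w p) ≡ proj₂ (actŴ w' p)

  vr : Ŵ → Vec n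
  vr w = actW (v w) (r w)

  Dominant : Ŵ → Set
  Dominant w = ∀ i → IsPosAffine (actŴ w (simple i , 0ℚ))

  -- s-minimal (θ is the highest root; α_0 = δ - θ)
  SMinimal : Vec n → Ŵ → Set
  SMinimal θ w = Dominant w
    × (∀ i → IsShort (simple i) → - 1ℚ ≤ proj₂ (actŴ⁻¹ w (simple i , 0ℚ)))
    × (∀ i → IsLong (simple i) → 0ℚ ≤ proj₂ (actŴ⁻¹ w (simple i , 0ℚ)))
    × 0ℚ ≤ proj₂ (actŴ⁻¹ w (0v -v θ , 1ℚ))

{-# OPTIONS --safe #-}
module Submission where

-- Write w = v·t_r. Then w⁻¹(α + kδ) = v⁻¹α + (k + (α, v(r)))δ, so the s-minimality
-- inequalities on w⁻¹(α_i) and w⁻¹(α₀) = w⁻¹(δ - θ) say exactly that v(r) ∈ D_min, and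
-- v(r) ∈ Q^∨ because W preserves Q^∨.
--
-- For the bijection, put x = v(r). Since (α_i, r) = (v α_i, x), w is dominant iff every
-- v α_i lies in the positive system Δ⁺⟨x⟩ = {γ : (γ,x) < 0, or (γ,x) = 0 and γ ∈ Δ⁺}
-- (for the case (α_i, r) < 0 one needs (α_i, r) ∈ ℤ, i.e. r ∈ Q^∨). Such a v exists and
-- is unique, because W acts simply transitively on positive systems: uniqueness since
-- an element sending all simple roots to positive roots is trivial (deletion argument
-- on words), existence by repeatedly appending a simple reflection s_i with
-- v α_i ∉ Δ⁺⟨x⟩, which lowers the number of positive roots that v sends outside Δ⁺⟨x⟩.
-- Then r = v⁻¹(x) is determined by x, and v·t_{v⁻¹x} is s-minimal whenever x ∈ D_min ∩ Q^∨.

open import Defs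
open import Data.Nat using (ℕ)
open import Data.Product using (Σ; ∃; _×_; _,_)
open import Function.Bundles using (_⇔_)

open import Data.Empty using (⊥; ⊥-elim)
open import Data.Fin as Fin using (Fin; zero; suc)
open import Data.Integer as ℤ using (ℤ)
import Data.Integer.Properties as ℤ
open import Data.List using (List; []; _∷_; _∷ʳ_; _++_; length; filter; reverse; initLast; _∷ʳ′_)
open import Data.List.Membership.Propositional using (_∈_; mapWith∈)
open import Data.List.Properties using (length-++; reverse-++; unfold-reverse; reverse-involutive)
open import Data.List.Relation.Unary.Any using (Any; here; there)
open import Data.List.Relation.Unary.Any.Properties using (mapWith∈⁺)
open import Data.Nat as ℕ using (zero; suc)
import Data.Nat.Properties as ℕ
open import Data.Nat.Coprimality using (1-coprimeTo) renaming (sym to coprime-sym)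
open import Data.Product using (proj₁; proj₂)
open import Data.Rational using (ℚ; 0ℚ; 1ℚ; _+_; _*_; -_; _-_; _≤_; _<_; mkℚ; *<*; 1/_; ≢-nonZero; nonNegative)
open import Data.Rational.Properties
open import Data.Sum using (_⊎_; inj₁; inj₂; [_,_]′)
open import Function.Bundles using (mk⇔; Equivalence)
open import Level using (0ℓ)
open import Relation.Binary.Definitions using (tri<; tri≈; tri>)
open import Relation.Binary.PropositionalEquality
open import Relation.Nullary using (¬_; yes; no)
open import Relation.Nullary.Decidable using (dec⇒maybe)
open import Relation.Unary using (Pred; Decidable)
open import Tactic.RingSolver using (solve-∀)
open import Tactic.RingSolver.Core.AlmostCommutativeRing using (AlmostCommutativeRing; fromCommutativeRing)

ℚ-ring : AlmostCommutativeRing 0ℓ 0ℓ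
ℚ-ring = fromCommutativeRing +-*-commutativeRing (λ x → dec⇒maybe (0ℚ ≟ x))

neg-involutive : ∀ p → - (- p) ≡ p
neg-involutive = solve-∀ ℚ-ring

-1*p≡-p : ∀ p → (- 1ℚ) * p ≡ - p
-1*p≡-p = solve-∀ ℚ-ring

0-p≡-p : ∀ p → 0ℚ - p ≡ - p
0-p≡-p p = +-identityˡ (- p)

-p≡0⇒p≡0 : ∀ {p} → - p ≡ 0ℚ → p ≡ 0ℚ
-p≡0⇒p≡0 {p} -p≡0 = trans (sym (neg-involutive p)) (cong -_ -p≡0)

-p<0⇒0<p : ∀ {p} → - p < 0ℚ → 0ℚ < p
-p<0⇒0<p {p} -p<0 = subst (0ℚ <_) (neg-involutive p) (neg-antimono-< -p<0)

0<-p⇒p<0 : ∀ {p} → 0ℚ < - p → p < 0ℚ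
0<-p⇒p<0 {p} 0<-p = subst (_< 0ℚ) (neg-involutive p) (neg-antimono-< 0<-p)

0<p⇒-p<0 : ∀ {p} → 0ℚ < p → - p < 0ℚ
0<p⇒-p<0 = neg-antimono-<

nonNeg≡-nonNeg⇒0 : ∀ {p q} → 0ℚ ≤ p → 0ℚ ≤ q → p ≡ - q → p ≡ 0ℚ
nonNeg≡-nonNeg⇒0 p≥0 q≥0 p≡-q = ≤-antisym (subst (_≤ 0ℚ) (sym p≡-q) (neg-antimono-≤ q≥0)) p≥0

0≤1-p⇔p≤1 : ∀ p → 0ℚ ≤ 1ℚ - p ⇔ p ≤ 1ℚ
0≤1-p⇔p≤1 p = mk⇔
  (λ 0≤1-p → subst₂ _≤_ (+-identityˡ p) (cancel p) (+-monoˡ-≤ p 0≤1-p))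
  (λ p≤1 → subst (_≤ 1ℚ - p) (+-inverseʳ p) (+-monoˡ-≤ (- p) p≤1))
  where cancel : ∀ p → 1ℚ - p + p ≡ 1ℚ
        cancel = solve-∀ ℚ-ring

*-cancelʳ-zero : ∀ p {q} → p * q ≡ 0ℚ → q ≢ 0ℚ → p ≡ 0ℚ
*-cancelʳ-zero p {q} pq≡0 q≢0 = begin
  p                ≡⟨ sym (trans (cong (p *_) (*-inverseʳ q)) (*-identityʳ p)) ⟩
  p * (q * 1/ q)   ≡⟨ sym (*-assoc p q (1/ q)) ⟩
  (p * q) * 1/ q   ≡⟨ cong (_* 1/ q) pq≡0 ⟩
  0ℚ * 1/ q        ≡⟨ *-zeroˡ (1/ q) ⟩
  0ℚ               ∎
  where open ≡-Reasoning
        instance _ = ≢-nonZero q≢0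

/'-inverse : ∀ p {q} → q ≢ 0ℚ → (p /' q) * q ≡ p
/'-inverse p {q} q≢0 with q ≟ 0ℚ
... | yes q≡0 = ⊥-elim (q≢0 q≡0)
... | no q≢0′ = trans (*-assoc p (1/ q) q) (trans (cong (p *_) (*-inverseˡ q)) (*-identityʳ p))
  where instance _ = ≢-nonZero q≢0′

ℤ→ℚ≡mkℚ : ∀ z → ℤ→ℚ z ≡ mkℚ z 0 (coprime-sym (1-coprimeTo _))
ℤ→ℚ≡mkℚ z = ↥p/↧p≡p (mkℚ z 0 (coprime-sym (1-coprimeTo _)))

ℤ→ℚ-+ : ∀ a b → ℤ→ℚ (a ℤ.+ b) ≡ ℤ→ℚ a + ℤ→ℚ b
ℤ→ℚ-+ a b rewrite ℤ→ℚ≡mkℚ a | ℤ→ℚ≡mkℚ b | ℤ.*-identityʳ a | ℤ.*-identityʳ b = refl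

ℤ→ℚ-* : ∀ a b → ℤ→ℚ (a ℤ.* b) ≡ ℤ→ℚ a * ℤ→ℚ b
ℤ→ℚ-* a b rewrite ℤ→ℚ≡mkℚ a | ℤ→ℚ≡mkℚ b = refl

ℤ→ℚ-neg : ∀ a → ℤ→ℚ (ℤ.- a) ≡ - ℤ→ℚ a
ℤ→ℚ-neg a rewrite ℤ→ℚ≡mkℚ a | ℤ→ℚ≡mkℚ (ℤ.- a) with a
... | ℤ.+ zero   = refl
... | ℤ.+[1+ m ] = refl
... | ℤ.-[1+ m ] = refl

ℤ→ℚ-update : ∀ a p m → ℤ→ℚ (a ℤ.- p ℤ.* ℤ.+ m) ≡ ℤ→ℚ a - ℤ→ℚ p * ℕ→ℚ m
ℤ→ℚ-update a p m = trans (ℤ→ℚ-+ a (ℤ.- (p ℤ.* ℤ.+ m)))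
  (cong (ℤ→ℚ a +_) (trans (ℤ→ℚ-neg (p ℤ.* ℤ.+ m)) (cong -_ (ℤ→ℚ-* p (ℤ.+ m)))))

ℤ→ℚ-cancel-< : ∀ {a b} → ℤ→ℚ a < ℤ→ℚ b → a ℤ.< b
ℤ→ℚ-cancel-< {a} {b} p rewrite ℤ→ℚ≡mkℚ a | ℤ→ℚ≡mkℚ b with p
... | *<* q = subst₂ ℤ._<_ (ℤ.*-identityʳ a) (ℤ.*-identityʳ b) q

ℕ→ℚ-nonNeg : ∀ m → 0ℚ ≤ ℕ→ℚ m
ℕ→ℚ-nonNeg m = subst (0ℚ ≤_) (sym (ℤ→ℚ≡mkℚ (ℤ.+ m))) (nonNegative⁻¹ _)

ℕ→ℚ-suc-pos : ∀ m → 0ℚ < ℕ→ℚ (suc m)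
ℕ→ℚ-suc-pos m = subst (0ℚ <_) (sym (ℤ→ℚ≡mkℚ (ℤ.+ suc m))) (positive⁻¹ _)

ℕ→ℚ≢-1 : ∀ m → ℕ→ℚ m ≢ - 1ℚ
ℕ→ℚ≢-1 m m≡-1 = <-irrefl refl (≤-<-trans (ℕ→ℚ-nonNeg m) (subst (_< 0ℚ) (sym m≡-1) (negative⁻¹ (- 1ℚ))))

Integral : ℚ → Set
Integral q = ∃ λ z → q ≡ ℤ→ℚ z

Integral-+ : ∀ {p q} → Integral p → Integral q → Integral (p + q)
Integral-+ (a , refl) (b , refl) = a ℤ.+ b , sym (ℤ→ℚ-+ a b)

Integral-* : ∀ {p q} → Integral p → Integral q → Integral (p * q)
Integral-* (a , refl) (b , refl) = a ℤ.* b , sym (ℤ→ℚ-* a b)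

Integral-∑ : ∀ {m} (f : Fin m → ℚ) → (∀ k → Integral (f k)) → Integral (∑ f)
Integral-∑ {zero}  f h = ℤ.+ 0 , refl
Integral-∑ {suc m} f h = Integral-+ (h zero) (Integral-∑ (λ k → f (suc k)) (λ k → h (suc k)))

negative-integral : ∀ {q} → Integral q → q < 0ℚ → ∃ λ m → 0ℚ - q ≡ ℕ→ℚ (suc m)
negative-integral (z , refl) q<0 with z | ℤ→ℚ-cancel-< {z} {ℤ.+ 0} q<0
... | ℤ.+ _      | ℤ.+<+ ()
... | ℤ.-[1+ m ] | _        = m , trans (0-p≡-p _) (sym (ℤ→ℚ-neg ℤ.-[1+ m ]))

∑-cong : ∀ {m} {f g : Fin m → ℚ} → (∀ k → f k ≡ g k) → ∑ f ≡ ∑ g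
∑-cong {zero}  e = refl
∑-cong {suc m} e = cong₂ _+_ (e zero) (∑-cong (λ k → e (suc k)))

∑-zero : ∀ m → ∑ {m} (λ _ → 0ℚ) ≡ 0ℚ
∑-zero zero    = refl
∑-zero (suc m) = cong (0ℚ +_) (∑-zero m)

∑-+ : ∀ {m} (f g : Fin m → ℚ) → ∑ (λ k → f k + g k) ≡ ∑ f + ∑ g
∑-+ {zero}  f g = refl
∑-+ {suc m} f g = begin
  (f zero + g zero) + ∑ (λ k → f′ k + g′ k)  ≡⟨ cong ((f zero + g zero) +_) (∑-+ f′ g′) ⟩
  (f zero + g zero) + (∑ f′ + ∑ g′)          ≡⟨ interchange (f zero) (g zero) (∑ f′) (∑ g′) ⟩
  (f zero + ∑ f′) + (g zero + ∑ g′)          ∎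
  where
  open ≡-Reasoning
  f′ g′ : Fin m → ℚ
  f′ k = f (suc k)
  g′ k = g (suc k)
  interchange : ∀ a b c d → (a + b) + (c + d) ≡ (a + c) + (b + d)
  interchange = solve-∀ ℚ-ring

∑-*ˡ : ∀ {m} c (f : Fin m → ℚ) → ∑ (λ k → c * f k) ≡ c * ∑ f
∑-*ˡ {zero}  c f = sym (*-zeroʳ c)
∑-*ˡ {suc m} c f = trans (cong (c * f zero +_) (∑-*ˡ c (λ k → f (suc k))))
                         (sym (*-distribˡ-+ c (f zero) (∑ (λ k → f (suc k)))))

∑-comm : ∀ {m l} (F : Fin m → Fin l → ℚ) → ∑ (λ i → ∑ (λ j → F i j)) ≡ ∑ (λ j → ∑ (λ i → F i j))
∑-comm {zero}  {l} F = sym (∑-zero l)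
∑-comm {suc m} {l} F = trans (cong (∑ (F zero) +_) (∑-comm (λ i → F (suc i))))
                             (sym (∑-+ (F zero) (λ j → ∑ (λ i → F (suc i) j))))

∑-nonPos : ∀ {m} (f : Fin m → ℚ) → (∀ k → f k ≤ 0ℚ) → ∑ f ≤ 0ℚ
∑-nonPos {zero}  f h = ≤-refl
∑-nonPos {suc m} f h = +-mono-≤ (h zero) (∑-nonPos (λ k → f (suc k)) (λ k → h (suc k)))

∑-nonPos-zero : ∀ {m} (f : Fin m → ℚ) → (∀ k → f k ≤ 0ℚ) → ∑ f ≡ 0ℚ → ∀ k → f k ≡ 0ℚ
∑-nonPos-zero {suc m} f h ∑f≡0 = λ { zero → proj₁ parts ; (suc k) → ∑-nonPos-zero f′ (λ k → h (suc k)) (proj₂ parts) k }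
  where
  f′ : Fin m → ℚ
  f′ k = f (suc k)
  nonPos-summands : ∀ {a b} → a ≤ 0ℚ → b ≤ 0ℚ → a + b ≡ 0ℚ → a ≡ 0ℚ × b ≡ 0ℚ
  nonPos-summands {a} {b} a≤0 b≤0 a+b≡0 =
    ≤-antisym a≤0 (subst₂ _≤_ a+b≡0 (+-identityʳ a) (+-monoʳ-≤ a b≤0)) ,
    ≤-antisym b≤0 (subst₂ _≤_ a+b≡0 (+-identityˡ b) (+-monoˡ-≤ b a≤0))
  parts : f zero ≡ 0ℚ × ∑ f′ ≡ 0ℚ
  parts = nonPos-summands (h zero) (∑-nonPos f′ (λ k → h (suc k))) ∑f≡0

δ : ∀ {m} → Fin m → Fin m → ℕ
δ zero    zero    = 1
δ zero    (suc k) = 0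
δ (suc i) zero    = 0
δ (suc i) (suc k) = δ i k

δ-diag : ∀ {m} (i : Fin m) → δ i i ≡ 1
δ-diag zero    = refl
δ-diag (suc i) = δ-diag i

δ-≢ : ∀ {m} {i k : Fin m} → i ≢ k → δ i k ≡ 0
δ-≢ {i = zero}  {zero}  i≢k = ⊥-elim (i≢k refl)
δ-≢ {i = zero}  {suc k} i≢k = refl
δ-≢ {i = suc i} {zero}  i≢k = refl
δ-≢ {i = suc i} {suc k} i≢k = δ-≢ (λ i≡k → i≢k (cong suc i≡k))

∑-δ : ∀ {m} (i : Fin m) (f : Fin m → ℚ) → ∑ (λ k → ℕ→ℚ (δ i k) * f k) ≡ f i
∑-δ {suc m} zero f = begin
  1ℚ * f zero + ∑ (λ k → 0ℚ * f (suc k))  ≡⟨ cong (1ℚ * f zero +_) (trans (∑-cong (λ k → *-zeroˡ (f (suc k)))) (∑-zero m)) ⟩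
  1ℚ * f zero + 0ℚ                        ≡⟨ trans (+-identityʳ (1ℚ * f zero)) (*-identityˡ (f zero)) ⟩
  f zero                                  ∎
  where open ≡-Reasoning
∑-δ {suc m} (suc i) f =
  trans (cong (_+ ∑ (λ k → ℕ→ℚ (δ i k) * f (suc k))) (*-zeroˡ (f zero)))
        (trans (+-identityˡ _) (∑-δ i (λ k → f (suc k))))

δ-off-diagonal : ∀ {m} c a {i k : Fin m} → i ≢ k → c - a * ℕ→ℚ (δ i k) ≡ c
δ-off-diagonal c a i≢k rewrite δ-≢ i≢k = trans (cong (λ t → c - t) (*-zeroʳ a)) (+-identityʳ c)

single-support : ∀ {m} (c : Fin m → ℚ) i → (∀ k → i ≢ k → c k ≡ 0ℚ) → ∀ k → c k ≡ c i * ℕ→ℚ (δ i k)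
single-support c i off k with i Fin.≟ k
... | yes refl = sym (trans (cong (λ t → c i * ℕ→ℚ t) (δ-diag i)) (*-identityʳ (c i)))
... | no i≢k   = trans (off k i≢k) (sym (trans (cong (λ t → c i * ℕ→ℚ t) (δ-≢ i≢k)) (*-zeroʳ (c i))))

all-or-some : ∀ {m} {P Q : Fin m → Set} → (∀ i → P i ⊎ Q i) → (∀ i → P i) ⊎ ∃ Q
all-or-some {zero}  d = inj₁ (λ ())
all-or-some {suc m} d with d zero | all-or-some (λ i → d (suc i))
... | inj₂ q  | _            = inj₂ (zero , q)
... | inj₁ _  | inj₂ (i , q) = inj₂ (suc i , q)
... | inj₁ p  | inj₁ ps      = inj₁ λ { zero → p ; (suc i) → ps i }

length-∷ʳ : ∀ {a} {A : Set a} (xs : List A) x → length (xs ∷ʳ x) ≡ suc (length xs)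
length-∷ʳ xs x = trans (length-++ xs) (ℕ.+-comm (length xs) 1)

module _ {a p q} {A : Set a} {P : Pred A p} {Q : Pred A q}
         (P? : Decidable P) (Q? : Decidable Q) (Q⇒P : ∀ {x} → Q x → P x) where

  length-filter-mono : ∀ xs → length (filter Q? xs) ℕ.≤ length (filter P? xs)
  length-filter-mono []       = ℕ.z≤n
  length-filter-mono (x ∷ xs) with Q? x | P? x
  ... | yes _  | yes _  = ℕ.s≤s (length-filter-mono xs)
  ... | yes qx | no ¬px = ⊥-elim (¬px (Q⇒P qx))
  ... | no _   | yes _  = ℕ.m≤n⇒m≤1+n (length-filter-mono xs)
  ... | no _   | no _   = length-filter-mono xs

  length-filter-< : ∀ xs → Any (λ x → P x × ¬ Q x) xs → length (filter Q? xs) ℕ.< length (filter P? xs)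
  length-filter-< (x ∷ xs) (here (px , ¬qx)) with Q? x | P? x
  ... | yes qx | _      = ⊥-elim (¬qx qx)
  ... | no _   | yes _  = ℕ.s≤s (length-filter-mono xs)
  ... | no _   | no ¬px = ⊥-elim (¬px px)
  length-filter-< (x ∷ xs) (there any) with Q? x | P? x
  ... | yes _  | yes _  = ℕ.s≤s (length-filter-< xs any)
  ... | yes qx | no ¬px = ⊥-elim (¬px (Q⇒P qx))
  ... | no _   | yes _  = ℕ.m≤n⇒m≤1+n (length-filter-< xs any)
  ... | no _   | no _   = length-filter-< xs any

module RootSystemTheory {n : ℕ} (R : RootSystem n) where
  open RootSystem R renaming (refl to reflection)

  ≗v-refl : {x : Vec n} → x ≗v x
  ≗v-refl i = refl

  ≗v-sym : {x y : Vec n} → x ≗v y → y ≗v x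
  ≗v-sym e i = sym (e i)

  ≗v-trans : {x y z : Vec n} → x ≗v y → y ≗v z → x ≗v z
  ≗v-trans e f i = trans (e i) (f i)

  negv : Vec n → Vec n
  negv x i = - x i

  negv-involutive : ∀ x → negv (negv x) ≗v x
  negv-involutive x i = neg-involutive (x i)

  -- Defs' lincomb over an arbitrary index set, so that one can induct on the index set.
  comb : ∀ {m} → (Fin m → ℚ) → (Fin m → Vec n) → Vec n
  comb c v j = ∑ (λ k → c k * v k j)

  comb-negv : ∀ {m} c (v : Fin m → Vec n) → negv (comb c v) ≗v comb (λ k → - c k) v
  comb-negv c v j = begin
    - ∑ f                             ≡⟨ sym (-1*p≡-p (∑ f)) ⟩
    (- 1ℚ) * ∑ f                      ≡⟨ sym (∑-*ˡ (- 1ℚ) f) ⟩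
    ∑ (λ k → (- 1ℚ) * (c k * v k j))  ≡⟨ ∑-cong (λ k → trans (sym (*-assoc (- 1ℚ) (c k) (v k j))) (cong (_* v k j) (-1*p≡-p (c k)))) ⟩
    ∑ (λ k → (- c k) * v k j)         ∎
    where
    open ≡-Reasoning
    f : Fin _ → ℚ
    f k = c k * v k j

  comb-sub : ∀ {m} a b (v : Fin m → Vec n) → comb (λ k → a k - b k) v ≗v (comb a v -v comb b v)
  comb-sub a b v j = begin
    ∑ (λ k → (a k - b k) * v k j)            ≡⟨ ∑-cong (λ k → *-distribʳ-+ (v k j) (a k) (- b k)) ⟩
    ∑ (λ k → a k * v k j + (- b k) * v k j)  ≡⟨ ∑-+ (λ k → a k * v k j) (λ k → (- b k) * v k j) ⟩
    comb a v j + comb (λ k → - b k) v j      ≡⟨ cong (comb a v j +_) (sym (comb-negv b v j)) ⟩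
    comb a v j - comb b v j                  ∎
    where open ≡-Reasoning

  comb-δ : ∀ {m} a (i : Fin m) (v : Fin m → Vec n) → comb (λ k → a * ℕ→ℚ (δ i k)) v ≗v (a ·v v i)
  comb-δ a i v j = trans (∑-cong (λ k → *-assoc a (ℕ→ℚ (δ i k)) (v k j)))
                         (trans (∑-*ˡ a (λ k → ℕ→ℚ (δ i k) * v k j)) (cong (a *_) (∑-δ i (λ k → v k j))))

  comb-update : ∀ {m} c a (i : Fin m) (v : Fin m → Vec n) →
                comb (λ k → c k - a * ℕ→ℚ (δ i k)) v ≗v (comb c v -v (a ·v v i))
  comb-update c a i v j =
    trans (comb-sub c (λ k → a * ℕ→ℚ (δ i k)) v j) (cong (λ t → comb c v j - t) (comb-δ a i v j))

  ⟪⟫-cong : ∀ {x x′ y y′} → x ≗v x′ → y ≗v y′ → ⟪ x , y ⟫ ≡ ⟪ x′ , y′ ⟫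
  ⟪⟫-cong ex ey = ∑-cong (λ i → ∑-cong (λ j → cong₂ (λ a b → a * gram i j * b) (ex i) (ey j)))

  ⟪⟫-congˡ : ∀ {x x′} y → x ≗v x′ → ⟪ x , y ⟫ ≡ ⟪ x′ , y ⟫
  ⟪⟫-congˡ y e = ⟪⟫-cong e (≗v-refl {y})

  ⟪⟫-congʳ : ∀ x {y y′} → y ≗v y′ → ⟪ x , y ⟫ ≡ ⟪ x , y′ ⟫
  ⟪⟫-congʳ x e = ⟪⟫-cong (≗v-refl {x}) e

  ⟪⟫-sym : ∀ x y → ⟪ x , y ⟫ ≡ ⟪ y , x ⟫
  ⟪⟫-sym x y = trans (∑-comm (λ i j → x i * gram i j * y j))
    (∑-cong (λ j → ∑-cong (λ i → trans (swap (x i) (gram i j) (y j)) (cong (λ g → y j * g * x i) (gram-sym i j)))))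
    where swap : ∀ a g b → a * g * b ≡ b * g * a
          swap = solve-∀ ℚ-ring

  ⟪+⟫ˡ : ∀ x y z → ⟪ x +v y , z ⟫ ≡ ⟪ x , z ⟫ + ⟪ y , z ⟫
  ⟪+⟫ˡ x y z = trans
    (∑-cong (λ i → trans (∑-cong (λ j → distrib (x i) (y i) (gram i j) (z j))) (∑-+ (xz i) (yz i))))
    (∑-+ (λ i → ∑ (xz i)) (λ i → ∑ (yz i)))
    where
    xz yz : Fin n → Fin n → ℚ
    xz i j = x i * gram i j * z j
    yz i j = y i * gram i j * z j
    distrib : ∀ a b g c → (a + b) * g * c ≡ a * g * c + b * g * c
    distrib = solve-∀ ℚ-ring

  ⟪·⟫ˡ : ∀ c x z → ⟪ c ·v x , z ⟫ ≡ c * ⟪ x , z ⟫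
  ⟪·⟫ˡ c x z = trans
    (∑-cong (λ i → trans (∑-cong (λ j → assoc c (x i) (gram i j) (z j))) (∑-*ˡ c (xz i))))
    (∑-*ˡ c (λ i → ∑ (xz i)))
    where
    xz : Fin n → Fin n → ℚ
    xz i j = x i * gram i j * z j
    assoc : ∀ c a g b → (c * a) * g * b ≡ c * (a * g * b)
    assoc = solve-∀ ℚ-ring

  ⟪0⟫ˡ : ∀ z → ⟪ 0v , z ⟫ ≡ 0ℚ
  ⟪0⟫ˡ z = trans (⟪⟫-congˡ {0v} {0ℚ ·v 0v} z ≗v-refl) (trans (⟪·⟫ˡ 0ℚ 0v z) (*-zeroˡ ⟪ 0v , z ⟫))

  ⟪negv⟫ˡ : ∀ x z → ⟪ negv x , z ⟫ ≡ - ⟪ x , z ⟫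
  ⟪negv⟫ˡ x z = trans (⟪⟫-congˡ z (λ i → sym (-1*p≡-p (x i)))) (trans (⟪·⟫ˡ (- 1ℚ) x z) (-1*p≡-p ⟪ x , z ⟫))

  ⟪-⟫ˡ : ∀ x y z → ⟪ x -v y , z ⟫ ≡ ⟪ x , z ⟫ - ⟪ y , z ⟫
  ⟪-⟫ˡ x y z = trans (⟪+⟫ˡ x (negv y) z) (cong (⟪ x , z ⟫ +_) (⟪negv⟫ˡ y z))

  ⟪comb⟫ˡ : ∀ {m} (c : Fin m → ℚ) (v : Fin m → Vec n) y → ⟪ comb c v , y ⟫ ≡ ∑ (λ k → c k * ⟪ v k , y ⟫)
  ⟪comb⟫ˡ {zero}  c v y = ⟪0⟫ˡ y
  ⟪comb⟫ˡ {suc m} c v y = trans (⟪+⟫ˡ (c zero ·v v zero) (comb (λ k → c (suc k)) (λ k → v (suc k))) y)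
    (cong₂ _+_ (⟪·⟫ˡ (c zero) (v zero) y) (⟪comb⟫ˡ (λ k → c (suc k)) (λ k → v (suc k)) y))

  ⟪·⟫ʳ : ∀ c x z → ⟪ z , c ·v x ⟫ ≡ c * ⟪ z , x ⟫
  ⟪·⟫ʳ c x z = trans (⟪⟫-sym z (c ·v x)) (trans (⟪·⟫ˡ c x z) (cong (c *_) (⟪⟫-sym x z)))

  ⟪-⟫ʳ : ∀ x y z → ⟪ z , x -v y ⟫ ≡ ⟪ z , x ⟫ - ⟪ z , y ⟫
  ⟪-⟫ʳ x y z = trans (⟪⟫-sym z (x -v y)) (trans (⟪-⟫ˡ x y z) (cong₂ _-_ (⟪⟫-sym x z) (⟪⟫-sym y z)))

  ⟪0⟫ʳ : ∀ z → ⟪ z , 0v ⟫ ≡ 0ℚ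
  ⟪0⟫ʳ z = trans (⟪⟫-sym z 0v) (⟪0⟫ˡ z)

  ⟪comb⟫ʳ : ∀ {m} (c : Fin m → ℚ) (v : Fin m → Vec n) y → ⟪ y , comb c v ⟫ ≡ ∑ (λ k → c k * ⟪ y , v k ⟫)
  ⟪comb⟫ʳ c v y = trans (⟪⟫-sym y (comb c v))
    (trans (⟪comb⟫ˡ c v y) (∑-cong (λ k → cong (c k *_) (⟪⟫-sym (v k) y))))

  ⟪⟫-definite : ∀ x → ⟪ x , x ⟫ ≡ 0ℚ → x ≗v 0v
  ⟪⟫-definite x e i with x i ≟ 0ℚ
  ... | yes xᵢ≡0 = xᵢ≡0
  ... | no xᵢ≢0 = ⊥-elim (<-irrefl (sym e) (gram-posdef x (i , xᵢ≢0)))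

  ⟪⟫-separating : ∀ {a b} → (∀ z → ⟪ z , a ⟫ ≡ ⟪ z , b ⟫) → a ≗v b
  ⟪⟫-separating {a} {b} h i =
    trans (sym (cancel (a i) (b i))) (trans (cong (_+ b i) (⟪⟫-definite (a -v b) a-b-null i)) (+-identityˡ (b i)))
    where
    a-b-null : ⟪ a -v b , a -v b ⟫ ≡ 0ℚ
    a-b-null = trans (⟪-⟫ʳ a b (a -v b)) (trans (cong (_- ⟪ a -v b , b ⟫) (h (a -v b))) (+-inverseʳ ⟪ a -v b , b ⟫))
    cancel : ∀ x y → (x - y) + y ≡ x
    cancel = solve-∀ ℚ-ring

  record IsLinear (f : Vec n → Vec n) : Set where
    field
      cong-≗ : ∀ {x y} → x ≗v y → f x ≗v f y
      +-homo : ∀ x y → f (x +v y) ≗v (f x +v f y)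
      ·-homo : ∀ c x → f (c ·v x) ≗v (c ·v f x)

    0-homo : f 0v ≗v 0v
    0-homo i = trans (cong-≗ {0v} {0ℚ ·v 0v} ≗v-refl i) (trans (·-homo 0ℚ 0v i) (*-zeroˡ (f 0v i)))

    comb-homo : ∀ {m} c (v : Fin m → Vec n) → f (comb c v) ≗v comb c (λ k → f (v k))
    comb-homo {zero}  c v = 0-homo
    comb-homo {suc m} c v i = trans (+-homo (c zero ·v v zero) (comb (λ k → c (suc k)) (λ k → v (suc k))) i)
      (cong₂ _+_ (·-homo (c zero) (v zero) i) (comb-homo (λ k → c (suc k)) (λ k → v (suc k)) i))

    negv-homo : ∀ x → f (negv x) ≗v negv (f x)
    negv-homo x i = trans (cong-≗ {negv x} {(- 1ℚ) ·v x} (λ j → sym (-1*p≡-p (x j))) i)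
                          (trans (·-homo (- 1ℚ) x i) (-1*p≡-p (f x i)))

    -v-homo : ∀ x y → f (x -v y) ≗v (f x -v f y)
    -v-homo x y i = trans (+-homo x (negv y) i) (cong (f x i +_) (negv-homo y i))

  ∘-linear : ∀ {f g} → IsLinear f → IsLinear g → IsLinear (λ x → f (g x))
  ∘-linear {f} {g} F G = record
    { cong-≗ = λ e → F.cong-≗ (G.cong-≗ e)
    ; +-homo = λ x y → ≗v-trans (F.cong-≗ (G.+-homo x y)) (F.+-homo (g x) (g y))
    ; ·-homo = λ c x → ≗v-trans (F.cong-≗ (G.·-homo c x)) (F.·-homo c (g x))
    }
    where module F = IsLinear F
          module G = IsLinear G

  -- Reflections and the Weyl group

  Anisotropic : Vec n → Set
  Anisotropic μ = ⟪ μ , μ ⟫ ≢ 0ℚ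

  ⟪,ᵛ⟫ : ∀ x μ → ⟪ x , μ ᵛ ⟫ ≡ (2ℚ /' ⟪ μ , μ ⟫) * ⟪ x , μ ⟫
  ⟪,ᵛ⟫ x μ = ⟪·⟫ʳ (2ℚ /' ⟪ μ , μ ⟫) μ x

  ⟪self,ᵛ⟫ : ∀ μ → Anisotropic μ → ⟪ μ , μ ᵛ ⟫ ≡ 2ℚ
  ⟪self,ᵛ⟫ μ μ≢0 = trans (⟪,ᵛ⟫ μ μ) (/'-inverse 2ℚ μ≢0)

  ᵛ-cong : ∀ {μ μ′} → μ ≗v μ′ → (μ ᵛ) ≗v (μ′ ᵛ)
  ᵛ-cong e j = cong₂ _*_ (cong (2ℚ /'_) (⟪⟫-cong e e)) (e j)

  reflection-congˡ : ∀ {μ μ′} x → μ ≗v μ′ → reflection μ x ≗v reflection μ′ x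
  reflection-congˡ x e i = cong (λ t → x i - t) (cong₂ _*_ (⟪⟫-congʳ x (ᵛ-cong e)) (e i))

  reflection-congʳ : ∀ μ {x x′} → x ≗v x′ → reflection μ x ≗v reflection μ x′
  reflection-congʳ μ e i = cong₂ _-_ (e i) (cong (_* μ i) (⟪⟫-congˡ (μ ᵛ) e))

  reflection-via-coroot : ∀ μ y → reflection μ y ≗v (y -v (⟪ y , μ ⟫ ·v (μ ᵛ)))
  reflection-via-coroot μ y j =
    cong (λ t → y j - t) (trans (cong (_* μ j) (⟪,ᵛ⟫ y μ)) (rearrange (2ℚ /' ⟪ μ , μ ⟫) ⟪ y , μ ⟫ (μ j)))
    where rearrange : ∀ c a b → c * a * b ≡ a * (c * b)
          rearrange = solve-∀ ℚ-ring

  reflection-linear : ∀ μ → IsLinear (reflection μ)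
  reflection-linear μ = record
    { cong-≗ = reflection-congʳ μ
    ; +-homo = λ x y i → trans (cong (λ t → (x i + y i) - t * μ i) (⟪+⟫ˡ x y (μ ᵛ)))
                               (split (x i) (y i) ⟪ x , μ ᵛ ⟫ ⟪ y , μ ᵛ ⟫ (μ i))
    ; ·-homo = λ c x i → trans (cong (λ t → c * x i - t * μ i) (⟪·⟫ˡ c x (μ ᵛ))) (factor c (x i) ⟪ x , μ ᵛ ⟫ (μ i))
    }
    where
    split : ∀ a b p q m → (a + b) - (p + q) * m ≡ (a - p * m) + (b - q * m)
    split = solve-∀ ℚ-ring
    factor : ∀ c a p m → c * a - (c * p) * m ≡ c * (a - p * m)
    factor = solve-∀ ℚ-ring

  reflection-self-adjoint : ∀ μ x y → ⟪ reflection μ x , y ⟫ ≡ ⟪ x , reflection μ y ⟫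
  reflection-self-adjoint μ x y = begin
    ⟪ x -v (⟪ x , μ ᵛ ⟫ ·v μ) , y ⟫       ≡⟨ ⟪-⟫ˡ x (⟪ x , μ ᵛ ⟫ ·v μ) y ⟩
    ⟪ x , y ⟫ - ⟪ ⟪ x , μ ᵛ ⟫ ·v μ , y ⟫  ≡⟨ cong (λ t → ⟪ x , y ⟫ - t) (⟪·⟫ˡ ⟪ x , μ ᵛ ⟫ μ y) ⟩
    ⟪ x , y ⟫ - ⟪ x , μ ᵛ ⟫ * ⟪ μ , y ⟫  ≡⟨ cong (λ t → ⟪ x , y ⟫ - t) coroot-swap ⟩
    ⟪ x , y ⟫ - ⟪ y , μ ᵛ ⟫ * ⟪ x , μ ⟫  ≡⟨ cong (λ t → ⟪ x , y ⟫ - t) (sym (⟪·⟫ʳ ⟪ y , μ ᵛ ⟫ μ x)) ⟩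
    ⟪ x , y ⟫ - ⟪ x , ⟪ y , μ ᵛ ⟫ ·v μ ⟫  ≡⟨ sym (⟪-⟫ʳ y (⟪ y , μ ᵛ ⟫ ·v μ) x) ⟩
    ⟪ x , y -v (⟪ y , μ ᵛ ⟫ ·v μ) ⟫       ∎
    where
    open ≡-Reasoning
    c = 2ℚ /' ⟪ μ , μ ⟫
    coroot-swap : ⟪ x , μ ᵛ ⟫ * ⟪ μ , y ⟫ ≡ ⟪ y , μ ᵛ ⟫ * ⟪ x , μ ⟫
    coroot-swap = begin
      ⟪ x , μ ᵛ ⟫ * ⟪ μ , y ⟫    ≡⟨ cong₂ _*_ (⟪,ᵛ⟫ x μ) (⟪⟫-sym μ y) ⟩
      c * ⟪ x , μ ⟫ * ⟪ y , μ ⟫  ≡⟨ rearrange c ⟪ x , μ ⟫ ⟪ y , μ ⟫ ⟩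
      c * ⟪ y , μ ⟫ * ⟪ x , μ ⟫  ≡⟨ cong (_* ⟪ x , μ ⟫) (sym (⟪,ᵛ⟫ y μ)) ⟩
      ⟪ y , μ ᵛ ⟫ * ⟪ x , μ ⟫    ∎
      where rearrange : ∀ c a b → c * a * b ≡ c * b * a
            rearrange = solve-∀ ℚ-ring

  ⟪reflection,ᵛ⟫ : ∀ μ x → Anisotropic μ → ⟪ reflection μ x , μ ᵛ ⟫ ≡ - ⟪ x , μ ᵛ ⟫
  ⟪reflection,ᵛ⟫ μ x μ≢0 = begin
    ⟪ x -v (a ·v μ) , μ ᵛ ⟫  ≡⟨ ⟪-⟫ˡ x (a ·v μ) (μ ᵛ) ⟩
    a - ⟪ a ·v μ , μ ᵛ ⟫     ≡⟨ cong (λ t → a - t) (trans (⟪·⟫ˡ a μ (μ ᵛ)) (cong (a *_) (⟪self,ᵛ⟫ μ μ≢0))) ⟩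
    a - a * 2ℚ               ≡⟨ a-2a a ⟩
    - a                      ∎
    where
    open ≡-Reasoning
    a = ⟪ x , μ ᵛ ⟫
    a-2a : ∀ a → a - a * (1ℚ + 1ℚ) ≡ - a
    a-2a = solve-∀ ℚ-ring

  reflection-involutive : ∀ μ x → Anisotropic μ → reflection μ (reflection μ x) ≗v x
  reflection-involutive μ x μ≢0 i =
    trans (cong (λ t → reflection μ x i - t * μ i) (⟪reflection,ᵛ⟫ μ x μ≢0)) (cancel (x i) ⟪ x , μ ᵛ ⟫ (μ i))
    where cancel : ∀ a b c → (a - b * c) - (- b) * c ≡ a
          cancel = solve-∀ ℚ-ring

  reflection-isometry : ∀ μ x y → Anisotropic μ → ⟪ reflection μ x , reflection μ y ⟫ ≡ ⟪ x , y ⟫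
  reflection-isometry μ x y μ≢0 =
    trans (reflection-self-adjoint μ x (reflection μ y)) (⟪⟫-congʳ x (reflection-involutive μ y μ≢0))

  reflection-self : ∀ μ → Anisotropic μ → reflection μ μ ≗v negv μ
  reflection-self μ μ≢0 i = trans (cong (λ t → μ i - t * μ i) (⟪self,ᵛ⟫ μ μ≢0)) (a-2a (μ i))
    where a-2a : ∀ a → a - (1ℚ + 1ℚ) * a ≡ - a
          a-2a = solve-∀ ℚ-ring

  isometry-conj : ∀ {f} → IsLinear f → (∀ x y → ⟪ f x , f y ⟫ ≡ ⟪ x , y ⟫) →
                  ∀ μ x → f (reflection μ x) ≗v reflection (f μ) (f x)
  isometry-conj {f} F f-isometry μ x i = begin
    f (x -v (⟪ x , μ ᵛ ⟫ ·v μ)) i    ≡⟨ F.-v-homo x (⟪ x , μ ᵛ ⟫ ·v μ) i ⟩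
    f x i - f (⟪ x , μ ᵛ ⟫ ·v μ) i   ≡⟨ cong (λ t → f x i - t) (F.·-homo ⟪ x , μ ᵛ ⟫ μ i) ⟩
    f x i - ⟪ x , μ ᵛ ⟫ * f μ i      ≡⟨ cong (λ t → f x i - t * f μ i) coefficient ⟩
    f x i - ⟪ f x , f μ ᵛ ⟫ * f μ i  ∎
    where
    open ≡-Reasoning
    module F = IsLinear F
    coefficient : ⟪ x , μ ᵛ ⟫ ≡ ⟪ f x , f μ ᵛ ⟫
    coefficient = begin
      ⟪ x , μ ᵛ ⟫                            ≡⟨ ⟪,ᵛ⟫ x μ ⟩
      (2ℚ /' ⟪ μ , μ ⟫) * ⟪ x , μ ⟫          ≡⟨ sym (cong₂ (λ a b → (2ℚ /' a) * b) (f-isometry μ μ) (f-isometry x μ)) ⟩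
      (2ℚ /' ⟪ f μ , f μ ⟫) * ⟪ f x , f μ ⟫  ≡⟨ sym (⟪,ᵛ⟫ (f x) (f μ)) ⟩
      ⟪ f x , f μ ᵛ ⟫                        ∎

  s : Fin n → Vec n → Vec n
  s i = reflection (simple i)

  root-anisotropic : ∀ {ρ} → ρ ∈ roots → Anisotropic ρ
  root-anisotropic {ρ} ρ∈Δ ρ≡0 = <⇒≢ (gram-posdef ρ (roots-nonzero ρ ρ∈Δ)) (sym ρ≡0)

  simple-anisotropic : ∀ i → Anisotropic (simple i)
  simple-anisotropic i = root-anisotropic (simple-roots i)

  actW-linear : ∀ w → IsLinear (actW w)
  actW-linear []      = record { cong-≗ = λ e → e ; +-homo = λ x y → ≗v-refl ; ·-homo = λ c x → ≗v-refl }
  actW-linear (i ∷ w) = ∘-linear (reflection-linear (simple i)) (actW-linear w)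

  actW-cong : ∀ w {x y} → x ≗v y → actW w x ≗v actW w y
  actW-cong w = IsLinear.cong-≗ (actW-linear w)

  actW-negv : ∀ w x → actW w (negv x) ≗v negv (actW w x)
  actW-negv w = IsLinear.negv-homo (actW-linear w)

  actW-isometry : ∀ w x y → ⟪ actW w x , actW w y ⟫ ≡ ⟪ x , y ⟫
  actW-isometry []      x y = refl
  actW-isometry (i ∷ w) x y =
    trans (reflection-isometry (simple i) (actW w x) (actW w y) (simple-anisotropic i)) (actW-isometry w x y)

  actW-++ : ∀ u w x → actW (u ++ w) x ≡ actW u (actW w x)
  actW-++ []      w x = refl
  actW-++ (i ∷ u) w x = cong (s i) (actW-++ u w x)

  actW-∷ʳ : ∀ w i x → actW (w ∷ʳ i) x ≡ actW w (s i x)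
  actW-∷ʳ w i x = actW-++ w (i ∷ []) x

  actW⁻¹-∷ : ∀ i w x → actW⁻¹ (i ∷ w) x ≡ actW⁻¹ w (s i x)
  actW⁻¹-∷ i w x = trans (cong (λ u → actW u x) (unfold-reverse i w)) (actW-∷ʳ (reverse w) i x)

  actW⁻¹-∷ʳ : ∀ w i x → actW⁻¹ (w ∷ʳ i) x ≡ s i (actW⁻¹ w x)
  actW⁻¹-∷ʳ w i x = cong (λ u → actW u x) (reverse-++ w (i ∷ []))

  actW-adjoint : ∀ w x y → ⟪ actW⁻¹ w x , y ⟫ ≡ ⟪ x , actW w y ⟫
  actW-adjoint []      x y = refl
  actW-adjoint (i ∷ w) x y = begin
    ⟪ actW⁻¹ (i ∷ w) x , y ⟫  ≡⟨ cong (λ t → ⟪ t , y ⟫) (actW⁻¹-∷ i w x) ⟩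
    ⟪ actW⁻¹ w (s i x) , y ⟫  ≡⟨ actW-adjoint w (s i x) y ⟩
    ⟪ s i x , actW w y ⟫      ≡⟨ reflection-self-adjoint (simple i) x (actW w y) ⟩
    ⟪ x , actW (i ∷ w) y ⟫    ∎
    where open ≡-Reasoning

  actW⁻¹-actW : ∀ w x → actW⁻¹ w (actW w x) ≗v x
  actW⁻¹-actW []      x = ≗v-refl
  actW⁻¹-actW (i ∷ w) x j = begin
    actW⁻¹ (i ∷ w) (actW (i ∷ w) x) j  ≡⟨ cong (λ t → t j) (actW⁻¹-∷ i w (actW (i ∷ w) x)) ⟩
    actW⁻¹ w (s i (s i (actW w x))) j  ≡⟨ actW-cong (reverse w) (reflection-involutive (simple i) (actW w x) (simple-anisotropic i)) j ⟩
    actW⁻¹ w (actW w x) j              ≡⟨ actW⁻¹-actW w x j ⟩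
    x j                                ∎
    where open ≡-Reasoning

  actW-actW⁻¹ : ∀ w x → actW w (actW⁻¹ w x) ≗v x
  actW-actW⁻¹ w x j =
    trans (cong (λ u → actW u (actW⁻¹ w x) j) (sym (reverse-involutive w))) (actW⁻¹-actW (reverse w) x j)

  actW-injective : ∀ w {x y} → actW w x ≗v actW w y → x ≗v y
  actW-injective w e = ≗v-trans (≗v-sym (actW⁻¹-actW w _)) (≗v-trans (actW-cong (reverse w) e) (actW⁻¹-actW w _))

  actW-conj : ∀ w j x → actW w (s j x) ≗v reflection (actW w (simple j)) (actW w x)
  actW-conj w j = isometry-conj (actW-linear w) (actW-isometry w) (simple j)

  actW-roots : ∀ w {ρ} → ρ ∈ roots → actW w ρ ∈ roots
  actW-roots []      ρ∈Δ = ρ∈Δ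
  actW-roots (i ∷ w) ρ∈Δ = roots-refl (simple i) _ (simple-roots i) (actW-roots w ρ∈Δ)

  IsRoot : Vec n → Set
  IsRoot y = ∃ λ ρ → ρ ∈ roots × y ≗v ρ

  ∈⇒IsRoot : ∀ {ρ} → ρ ∈ roots → IsRoot ρ
  ∈⇒IsRoot ρ∈Δ = _ , ρ∈Δ , ≗v-refl

  simple-IsRoot : ∀ i → IsRoot (simple i)
  simple-IsRoot i = ∈⇒IsRoot (simple-roots i)

  IsRoot-anisotropic : ∀ {y} → IsRoot y → Anisotropic y
  IsRoot-anisotropic (ρ , ρ∈Δ , y≗ρ) y≡0 = root-anisotropic ρ∈Δ (trans (⟪⟫-cong (≗v-sym y≗ρ) (≗v-sym y≗ρ)) y≡0)

  IsRoot-actW : ∀ w {y} → IsRoot y → IsRoot (actW w y)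
  IsRoot-actW w (ρ , ρ∈Δ , y≗ρ) = actW w ρ , actW-roots w ρ∈Δ , actW-cong w y≗ρ

  IsRoot-negv : ∀ {y} → IsRoot y → IsRoot (negv y)
  IsRoot-negv (ρ , ρ∈Δ , y≗ρ) = reflection ρ ρ , roots-refl ρ ρ ρ∈Δ ρ∈Δ ,
    ≗v-trans (λ i → cong -_ (y≗ρ i)) (≗v-sym (reflection-self ρ (root-anisotropic ρ∈Δ)))

  coordinates-unique : ∀ a b → lincomb a simple ≗v lincomb b simple → ∀ k → a k ≡ b k
  coordinates-unique a b e k = a-b≡0⇒a≡b (simple-indep (λ k → a k - b k) difference≗0 k)
    where
    difference≗0 : lincomb (λ k → a k - b k) simple ≗v 0v
    difference≗0 j = trans (comb-sub a b simple j)
                           (trans (cong (λ t → lincomb a simple j - t) (sym (e j))) (+-inverseʳ (lincomb a simple j)))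
    a-b≡0⇒a≡b : a k - b k ≡ 0ℚ → a k ≡ b k
    a-b≡0⇒a≡b d = trans (sym (cancel (a k) (b k))) (trans (cong (_+ b k) d) (+-identityˡ (b k)))
      where cancel : ∀ x y → (x - y) + y ≡ x
            cancel = solve-∀ ℚ-ring

  Pos : Vec n → Set
  Pos y = ∃ λ (c : Fin n → ℕ) → y ≗v lincomb (λ i → ℕ→ℚ (c i)) simple

  Neg : Vec n → Set
  Neg y = Pos (negv y)

  Pos-cong : ∀ {x y} → x ≗v y → Pos x → Pos y
  Pos-cong e (c , x≗c) = c , ≗v-trans (≗v-sym e) x≗c

  simple-Pos : ∀ i → Pos (simple i)
  simple-Pos i = δ i , λ j → sym (∑-δ i (λ k → simple k j))

  sign : ∀ {y} → IsRoot y → Pos y ⊎ Neg y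
  sign (ρ , ρ∈Δ , y≗ρ) with simple-base ρ ρ∈Δ
  ... | c , inj₁ ρ≗c  = inj₁ (c , ≗v-trans y≗ρ ρ≗c)
  ... | c , inj₂ ρ≗-c = inj₂ (c , ≗v-trans (λ i → cong -_ (≗v-trans y≗ρ ρ≗-c i))
                                  (≗v-trans (comb-negv (λ i → - ℕ→ℚ (c i)) simple)
                                            (λ j → ∑-cong (λ k → cong (_* simple k j) (neg-involutive (ℕ→ℚ (c k)))))))

  Nonneg : Vec n → Set
  Nonneg y = ∃ λ a → (∀ i → 0ℚ ≤ a i) × y ≗v lincomb a simple

  Nonneg-cong : ∀ {x y} → x ≗v y → Nonneg x → Nonneg y
  Nonneg-cong e (a , a≥0 , x≗a) = a , a≥0 , ≗v-trans (≗v-sym e) x≗a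

  Pos⇒Nonneg : ∀ {y} → Pos y → Nonneg y
  Pos⇒Nonneg (c , y≗c) = (λ i → ℕ→ℚ (c i)) , (λ i → ℕ→ℚ-nonNeg (c i)) , y≗c

  Nonneg-zero : ∀ {y} → y ≗v 0v → Nonneg y
  Nonneg-zero y≗0 = (λ _ → 0ℚ) , (λ _ → ≤-refl) ,
    ≗v-trans y≗0 (λ j → sym (trans (∑-cong (λ k → *-zeroˡ (simple k j))) (∑-zero n)))

  Nonneg-+ : ∀ {y z} → Nonneg y → Nonneg z → Nonneg (y +v z)
  Nonneg-+ (a , a≥0 , y≗a) (b , b≥0 , z≗b) = (λ k → a k + b k) , (λ k → +-mono-≤ (a≥0 k) (b≥0 k)) ,
    λ j → trans (cong₂ _+_ (y≗a j) (z≗b j))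
                (trans (sym (∑-+ (λ k → a k * simple k j) (λ k → b k * simple k j)))
                       (∑-cong (λ k → sym (*-distribʳ-+ (simple k j) (a k) (b k)))))

  Nonneg-· : ∀ {c y} → 0ℚ ≤ c → Nonneg y → Nonneg (c ·v y)
  Nonneg-· {c} c≥0 (a , a≥0 , y≗a) = (λ k → c * a k) ,
    (λ k → subst (_≤ c * a k) (*-zeroʳ c) (*-monoˡ-≤-nonNeg c {{nonNegative c≥0}} (a≥0 k))) ,
    λ j → trans (cong (c *_) (y≗a j))
                (trans (sym (∑-*ˡ c (λ k → a k * simple k j))) (∑-cong (λ k → sym (*-assoc c (a k) (simple k j)))))

  Nonneg-comb : ∀ {m} c (v : Fin m → Vec n) → (∀ k → Nonneg (c k ·v v k)) → Nonneg (comb c v)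
  Nonneg-comb {zero}  c v h = Nonneg-zero ≗v-refl
  Nonneg-comb {suc m} c v h = Nonneg-+ (h zero) (Nonneg-comb (λ k → c (suc k)) (λ k → v (suc k)) (λ k → h (suc k)))

  Nonneg-antisym : ∀ {y} → Nonneg y → Nonneg (negv y) → y ≗v 0v
  Nonneg-antisym {y} (a , a≥0 , y≗a) (b , b≥0 , -y≗b) j =
    trans (y≗a j) (trans (∑-cong (λ k → trans (cong (_* simple k j) (a≡0 k)) (*-zeroˡ (simple k j)))) (∑-zero n))
    where
    a≡-b : ∀ k → a k ≡ - b k
    a≡-b = coordinates-unique a (λ k → - b k)
      (≗v-trans (≗v-sym y≗a) (≗v-trans (≗v-sym (negv-involutive y))
        (≗v-trans (λ i → cong -_ (-y≗b i)) (comb-negv b simple))))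
    a≡0 : ∀ k → a k ≡ 0ℚ
    a≡0 k = nonNeg≡-nonNeg⇒0 (a≥0 k) (b≥0 k) (a≡-b k)

  Nonneg-root-exclusive : ∀ {y} → IsRoot y → Nonneg y → Nonneg (negv y) → ⊥
  Nonneg-root-exclusive y∈Δ y≥0 -y≥0 = IsRoot-anisotropic y∈Δ (trans (⟪⟫-cong y≗0 y≗0) (⟪0⟫ˡ 0v))
    where y≗0 = Nonneg-antisym y≥0 -y≥0

  Pos-Neg-exclusive : ∀ {y} → IsRoot y → Pos y → Neg y → ⊥
  Pos-Neg-exclusive y∈Δ pos neg = Nonneg-root-exclusive y∈Δ (Pos⇒Nonneg pos) (Pos⇒Nonneg neg)

  Nonneg-root⇒Pos : ∀ {y} → IsRoot y → Nonneg y → Pos y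
  Nonneg-root⇒Pos y∈Δ y≥0 = [ (λ pos → pos) , (λ neg → ⊥-elim (Nonneg-root-exclusive y∈Δ y≥0 (Pos⇒Nonneg neg))) ]′ (sign y∈Δ)

  -- The coordinates of y and s_i y differ only at i; reducedness pins down the multiple of α_i.
  s-Neg⇒simple : ∀ i {y} → IsRoot y → Pos y → Neg (s i y) → y ≗v simple i
  s-Neg⇒simple i {y} (ρ , ρ∈Δ , y≗ρ) (c , y≗c) (e , -sy≗e) j =
    trans (y≗cᵢαᵢ j) (trans (comb-δ (C i) i simple j) (trans (cong (_* simple i j) cᵢ≡1) (*-identityˡ (simple i j))))
    where
    C E : Fin n → ℚ
    C k = ℕ→ℚ (c k)
    E k = ℕ→ℚ (e k)
    a = ⟪ y , simple i ᵛ ⟫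
    coordinates-of-sy : ∀ k → C k - a * ℕ→ℚ (δ i k) ≡ - E k
    coordinates-of-sy = coordinates-unique _ _ (λ j → begin
      comb (λ k → C k - a * ℕ→ℚ (δ i k)) simple j  ≡⟨ comb-update C a i simple j ⟩
      lincomb C simple j - a * simple i j           ≡⟨ cong (λ t → t - a * simple i j) (sym (y≗c j)) ⟩
      s i y j                                       ≡⟨ sym (negv-involutive (s i y) j) ⟩
      - negv (s i y) j                              ≡⟨ cong -_ (-sy≗e j) ⟩
      - lincomb E simple j                          ≡⟨ comb-negv E simple j ⟩
      lincomb (λ k → - E k) simple j                ∎)
      where open ≡-Reasoning
    C-off-diagonal : ∀ k → i ≢ k → C k ≡ 0ℚ
    C-off-diagonal k i≢k = nonNeg≡-nonNeg⇒0 (ℕ→ℚ-nonNeg (c k)) (ℕ→ℚ-nonNeg (e k))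
      (trans (sym (δ-off-diagonal (C k) a i≢k)) (coordinates-of-sy k))
    y≗cᵢαᵢ : y ≗v comb (λ k → C i * ℕ→ℚ (δ i k)) simple
    y≗cᵢαᵢ j = trans (y≗c j) (∑-cong (λ k → cong (_* simple k j) (single-support C i C-off-diagonal k)))
    cᵢ≡1 : C i ≡ 1ℚ
    cᵢ≡1 = [ (λ cᵢ≡1 → cᵢ≡1) , (λ cᵢ≡-1 → ⊥-elim (ℕ→ℚ≢-1 (c i) cᵢ≡-1)) ]′
             (roots-reduced (simple i) ρ (C i) (simple-roots i) ρ∈Δ
               (≗v-trans (≗v-sym y≗ρ) (≗v-trans y≗cᵢαᵢ (comb-δ (C i) i simple))))

  -- If w = s_i w₀ with w₀ α_j > 0, then w₀ α_j = α_i, hence w₀ s_j = s_i w₀ and w s_j = w₀.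
  deletion : ∀ w j → Neg (actW w (simple j)) →
             ∃ λ w′ → length w ≡ suc (length w′) × (∀ x → actW (w ∷ʳ j) x ≗v actW w′ x)
  deletion []      j neg = ⊥-elim (Pos-Neg-exclusive (simple-IsRoot j) (simple-Pos j) neg)
  deletion (i ∷ w) j neg with sign (IsRoot-actW w (simple-IsRoot j))
  ... | inj₂ neg′ with deletion w j neg′
  ...   | w′ , len , eq = i ∷ w′ , cong suc len , λ x → reflection-congʳ (simple i) (eq x)
  deletion (i ∷ w) j neg | inj₁ pos = w , refl , collapse
    where
    wαⱼ≗αᵢ : actW w (simple j) ≗v simple i
    wαⱼ≗αᵢ = s-Neg⇒simple i (IsRoot-actW w (simple-IsRoot j)) pos neg
    collapse : ∀ x → actW ((i ∷ w) ∷ʳ j) x ≗v actW w x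
    collapse x k = begin
      s i (actW (w ∷ʳ j) x) k                            ≡⟨ cong (λ t → s i t k) (actW-∷ʳ w j x) ⟩
      s i (actW w (s j x)) k                             ≡⟨ reflection-congʳ (simple i) (actW-conj w j x) k ⟩
      s i (reflection (actW w (simple j)) (actW w x)) k  ≡⟨ reflection-congʳ (simple i) (reflection-congˡ (actW w x) wαⱼ≗αᵢ) k ⟩
      s i (s i (actW w x)) k                             ≡⟨ reflection-involutive (simple i) (actW w x) (simple-anisotropic i) k ⟩
      actW w x k                                         ∎
      where open ≡-Reasoning

  Pos-∷ʳ⇒Neg : ∀ w j → Pos (actW (w ∷ʳ j) (simple j)) → Neg (actW w (simple j))
  Pos-∷ʳ⇒Neg w j = Pos-cong (≗v-trans (λ i → cong (λ t → t i) (actW-∷ʳ w j (simple j)))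
                             (≗v-trans (actW-cong w (reflection-self (simple j) (simple-anisotropic j)))
                                       (actW-negv w (simple j))))

  simple-Pos⇒trivial : ∀ k w → length w ℕ.≤ k → (∀ j → Pos (actW w (simple j))) → ∀ x → actW w x ≗v x
  simple-Pos⇒trivial k w len pos with initLast w
  ... | [] = λ x → ≗v-refl
  simple-Pos⇒trivial zero    .(w ∷ʳ j) len pos | w ∷ʳ′ j = ⊥-elim (ℕ.n≮0 (subst (ℕ._≤ 0) (length-∷ʳ w j) len))
  simple-Pos⇒trivial (suc k) .(w ∷ʳ j) len pos | w ∷ʳ′ j = shorten (deletion w j (Pos-∷ʳ⇒Neg w j (pos j)))
    where
    shorten : (∃ λ w′ → length w ≡ suc (length w′) × (∀ x → actW (w ∷ʳ j) x ≗v actW w′ x)) →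
              ∀ x → actW (w ∷ʳ j) x ≗v x
    shorten (w′ , len′ , eq) x =
      ≗v-trans (eq x) (simple-Pos⇒trivial k w′ w′≤k (λ i → Pos-cong (eq (simple i)) (pos i)) x)
      where
      w′≤k : length w′ ℕ.≤ k
      w′≤k = ℕ.≤-trans (ℕ.n≤1+n (length w′)) (subst (ℕ._≤ k) len′ (ℕ.s≤s⁻¹ (subst (ℕ._≤ suc k) (length-∷ʳ w j) len)))

  -- Positive systems, and the simply transitive action of W on them

  Pos⟨_⟩ : Vec n → Vec n → Set
  Pos⟨ x ⟩ γ = (⟪ γ , x ⟫ < 0ℚ) ⊎ (⟪ γ , x ⟫ ≡ 0ℚ × Pos γ)

  Pos⟨⟩-cong : ∀ {x γ γ′} → γ ≗v γ′ → Pos⟨ x ⟩ γ → Pos⟨ x ⟩ γ′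
  Pos⟨⟩-cong {x} e (inj₁ γ<0)         = inj₁ (subst (_< 0ℚ) (⟪⟫-congˡ x e) γ<0)
  Pos⟨⟩-cong {x} e (inj₂ (γ≡0 , pos)) = inj₂ (trans (sym (⟪⟫-congˡ x e)) γ≡0 , Pos-cong e pos)

  Pos⟨⟩-congˣ : ∀ {x x′ γ} → x ≗v x′ → Pos⟨ x ⟩ γ → Pos⟨ x′ ⟩ γ
  Pos⟨⟩-congˣ {γ = γ} e (inj₁ γ<0)         = inj₁ (subst (_< 0ℚ) (⟪⟫-congʳ γ e) γ<0)
  Pos⟨⟩-congˣ {γ = γ} e (inj₂ (γ≡0 , pos)) = inj₂ (trans (sym (⟪⟫-congʳ γ e)) γ≡0 , pos)

  Pos⟨⟩-dichotomy : ∀ x {γ} → IsRoot γ → Pos⟨ x ⟩ γ ⊎ Pos⟨ x ⟩ (negv γ)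
  Pos⟨⟩-dichotomy x {γ} γ∈Δ with <-cmp ⟪ γ , x ⟫ 0ℚ
  ... | tri< γ<0 _ _ = inj₁ (inj₁ γ<0)
  ... | tri> _ _ γ>0 = inj₂ (inj₁ (subst (_< 0ℚ) (sym (⟪negv⟫ˡ γ x)) (0<p⇒-p<0 γ>0)))
  ... | tri≈ _ γ≡0 _ with sign γ∈Δ
  ...   | inj₁ pos = inj₁ (inj₂ (γ≡0 , pos))
  ...   | inj₂ neg = inj₂ (inj₂ (trans (⟪negv⟫ˡ γ x) (cong -_ γ≡0) , neg))

  Pos⟨⟩-negv : ∀ x {γ} → Pos⟨ x ⟩ (negv γ) → (0ℚ < ⟪ γ , x ⟫) ⊎ (⟪ γ , x ⟫ ≡ 0ℚ × Neg γ)
  Pos⟨⟩-negv x {γ} (inj₁ -γ<0)         = inj₁ (-p<0⇒0<p (subst (_< 0ℚ) (⟪negv⟫ˡ γ x) -γ<0))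
  Pos⟨⟩-negv x {γ} (inj₂ (-γ≡0 , neg)) = inj₂ (-p≡0⇒p≡0 (trans (sym (⟪negv⟫ˡ γ x)) -γ≡0) , neg)

  Pos⟨⟩-exclusive : ∀ x {γ} → IsRoot γ → Pos⟨ x ⟩ γ → Pos⟨ x ⟩ (negv γ) → ⊥
  Pos⟨⟩-exclusive x γ∈Δ below above with below | Pos⟨⟩-negv x above
  ... | inj₁ γ<0       | inj₁ γ>0       = <-asym γ<0 γ>0
  ... | inj₁ γ<0       | inj₂ (γ≡0 , _) = <-irrefl γ≡0 γ<0
  ... | inj₂ (γ≡0 , _) | inj₁ γ>0       = <-irrefl (sym γ≡0) γ>0
  ... | inj₂ (_ , pos) | inj₂ (_ , neg) = Pos-Neg-exclusive γ∈Δ pos neg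

  -- V maps Δ⁺ into Δ⁺⟨x⟩ (checking the simple roots suffices, by Adapted-Pos).
  Adapted : Vec n → List (Fin n) → Set
  Adapted x V = ∀ i → Pos⟨ x ⟩ (actW V (simple i))

  Adapted-congˣ : ∀ {x x′} V → x ≗v x′ → Adapted x V → Adapted x′ V
  Adapted-congˣ V e adapted i = Pos⟨⟩-congˣ e (adapted i)

  -- (Vβ, x) = ∑ c_k (Vα_k, x) is a sum of nonpositive terms; if it vanishes, only the
  -- α_k with Vα_k ∈ Δ⁺ contribute to Vβ = ∑ c_k Vα_k.
  Adapted-Pos : ∀ {x} V → Adapted x V → ∀ {β} → IsRoot β → Pos β → Pos⟨ x ⟩ (actW V β)
  Adapted-Pos {x} V adapted {β} β∈Δ (c , β≗c) with ⟪ actW V β , x ⟫ <? 0ℚ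
  ... | yes Vβ<0 = inj₁ Vβ<0
  ... | no  Vβ≮0 = inj₂ (on-hyperplane , Nonneg-root⇒Pos (IsRoot-actW V β∈Δ) (Nonneg-cong (≗v-sym Vβ≗) nonneg))
    where
    C t : Fin n → ℚ
    C k = ℕ→ℚ (c k)
    t k = ⟪ actW V (simple k) , x ⟫
    Vβ≗ : actW V β ≗v comb C (λ k → actW V (simple k))
    Vβ≗ = ≗v-trans (actW-cong V β≗c) (IsLinear.comb-homo (actW-linear V) C simple)
    pairing : ⟪ actW V β , x ⟫ ≡ ∑ (λ k → C k * t k)
    pairing = trans (⟪⟫-congˡ x Vβ≗) (⟪comb⟫ˡ C (λ k → actW V (simple k)) x)
    t≤0 : ∀ k → t k ≤ 0ℚ
    t≤0 k = [ <⇒≤ , (λ (t≡0 , _) → ≤-reflexive t≡0) ]′ (adapted k)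
    term≤0 : ∀ k → C k * t k ≤ 0ℚ
    term≤0 k = subst (C k * t k ≤_) (*-zeroʳ (C k)) (*-monoˡ-≤-nonNeg (C k) {{nonNegative (ℕ→ℚ-nonNeg (c k))}} (t≤0 k))
    on-hyperplane : ⟪ actW V β , x ⟫ ≡ 0ℚ
    on-hyperplane = ≤-antisym (subst (_≤ 0ℚ) (sym pairing) (∑-nonPos (λ k → C k * t k) term≤0)) (≮⇒≥ Vβ≮0)
    term≡0 : ∀ k → C k * t k ≡ 0ℚ
    term≡0 = ∑-nonPos-zero (λ k → C k * t k) term≤0 (trans (sym pairing) on-hyperplane)
    term-Nonneg : ∀ k → Nonneg (C k ·v actW V (simple k))
    term-Nonneg k with adapted k
    ... | inj₁ t<0 = Nonneg-zero (λ j → trans (cong (_* actW V (simple k) j) (*-cancelʳ-zero (C k) (term≡0 k) (<⇒≢ t<0)))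
                                              (*-zeroˡ (actW V (simple k) j)))
    ... | inj₂ (_ , pos) = Nonneg-· (ℕ→ℚ-nonNeg (c k)) (Pos⇒Nonneg pos)
    nonneg : Nonneg (comb C (λ k → actW V (simple k)))
    nonneg = Nonneg-comb C (λ k → actW V (simple k)) term-Nonneg

  -- u = V⁻¹V′ keeps every α_j positive: otherwise V(-u α_j) = -V′α_j would lie in Δ⁺⟨x⟩
  -- by Adapted-Pos, next to V′α_j.
  Adapted-unique : ∀ {x} V V′ → Adapted x V → Adapted x V′ → ∀ y → actW V y ≗v actW V′ y
  Adapted-unique {x} V V′ V-adapted V′-adapted y =
    ≗v-trans (actW-cong V (≗v-sym (u-trivial y)))
             (≗v-trans (λ j → cong (λ t → actW V t j) (actW-++ (reverse V) V′ y)) (actW-actW⁻¹ V (actW V′ y)))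
    where
    u = reverse V ++ V′
    u-simple-Pos : ∀ j → Pos (actW u (simple j))
    u-simple-Pos j with sign (IsRoot-actW (reverse V) (IsRoot-actW V′ (simple-IsRoot j)))
    ... | inj₁ pos = subst Pos (sym (actW-++ (reverse V) V′ (simple j))) pos
    ... | inj₂ neg = ⊥-elim (Pos⟨⟩-exclusive x (IsRoot-actW V′ (simple-IsRoot j)) (V′-adapted j)
                       (Pos⟨⟩-cong V-neg≗ (Adapted-Pos V V-adapted (IsRoot-negv (IsRoot-actW (reverse V) (IsRoot-actW V′ (simple-IsRoot j)))) neg)))
      where
      V-neg≗ : actW V (negv (actW⁻¹ V (actW V′ (simple j)))) ≗v negv (actW V′ (simple j))
      V-neg≗ = ≗v-trans (actW-negv V _) (λ i → cong -_ (actW-actW⁻¹ V (actW V′ (simple j)) i))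
    u-trivial : ∀ y → actW u y ≗v y
    u-trivial = simple-Pos⇒trivial (length u) u ℕ.≤-refl u-simple-Pos

  module _ (x : Vec n) where

    Root : Set
    Root = Σ (Vec n) (_∈ roots)

    root : ∀ {ρ} → ρ ∈ roots → Root
    root {ρ} ρ∈Δ = ρ , ρ∈Δ

    all-roots : List Root
    all-roots = mapWith∈ roots root

    -- γ = V β for a positive root β that V sends outside Δ⁺⟨x⟩. Counting such γ over the
    -- fixed list of roots does not require that list to be free of repetitions.
    Misplaced : List (Fin n) → Root → Set
    Misplaced V (γ , _) = Pos⟨ x ⟩ (negv γ) × Pos (actW⁻¹ V γ)

    misplaced? : ∀ V → Decidable (Misplaced V)
    misplaced? V (γ , γ∈Δ) with Pos⟨⟩-dichotomy x (∈⇒IsRoot γ∈Δ) | sign (IsRoot-actW (reverse V) (∈⇒IsRoot γ∈Δ))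
    ... | inj₁ below | _        = no λ (above , _) → Pos⟨⟩-exclusive x (∈⇒IsRoot γ∈Δ) below above
    ... | inj₂ above | inj₁ pos = yes (above , pos)
    ... | inj₂ _     | inj₂ neg = no λ (_ , pos) → Pos-Neg-exclusive (IsRoot-actW (reverse V) (∈⇒IsRoot γ∈Δ)) pos neg

    misplaced-count : List (Fin n) → ℕ
    misplaced-count V = length (filter (misplaced? V) all-roots)

    -- s_i permutes Δ⁺ ∖ {α_i}, so appending i only removes V α_i from the misplaced set.
    misplaced-count-∷ʳ : ∀ V i → Pos⟨ x ⟩ (negv (actW V (simple i))) →
                         misplaced-count (V ∷ʳ i) ℕ.< misplaced-count V
    misplaced-count-∷ʳ V i Vαᵢ-above =
      length-filter-< (misplaced? V) (misplaced? (V ∷ʳ i)) (λ {γ} → stays-misplaced {γ}) all-roots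
        (mapWith∈⁺ root (actW V (simple i) , actW-roots V (simple-roots i) , (Vαᵢ-above , αᵢ-Pos) , leaves))
      where
      αᵢ-Pos : Pos (actW⁻¹ V (actW V (simple i)))
      αᵢ-Pos = Pos-cong (≗v-sym (actW⁻¹-actW V (simple i))) (simple-Pos i)
      leaves : ¬ Misplaced (V ∷ʳ i) (actW V (simple i) , actW-roots V (simple-roots i))
      leaves (_ , pos) = Pos-Neg-exclusive (simple-IsRoot i) (simple-Pos i) (Pos-cong -αᵢ≗ pos)
        where
        -αᵢ≗ : actW⁻¹ (V ∷ʳ i) (actW V (simple i)) ≗v negv (simple i)
        -αᵢ≗ = ≗v-trans (λ j → cong (λ t → t j) (actW⁻¹-∷ʳ V i (actW V (simple i))))
                 (≗v-trans (reflection-congʳ (simple i) (actW⁻¹-actW V (simple i)))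
                           (reflection-self (simple i) (simple-anisotropic i)))
      stays-misplaced : ∀ {γ} → Misplaced (V ∷ʳ i) γ → Misplaced V γ
      stays-misplaced {γ , γ∈Δ} (above , pos) with sign (IsRoot-actW (reverse V) (∈⇒IsRoot γ∈Δ))
      ... | inj₁ pos′ = above , pos′
      ... | inj₂ neg = ⊥-elim (Pos⟨⟩-exclusive x (IsRoot-actW V (simple-IsRoot i)) Vαᵢ-below Vαᵢ-above)
        where
        β = actW⁻¹ V γ
        sᵢβ-Pos : Pos (s i β)
        sᵢβ-Pos = subst Pos (actW⁻¹-∷ʳ V i γ) pos
        -β≗αᵢ : negv β ≗v simple i
        -β≗αᵢ = s-Neg⇒simple i (IsRoot-negv (IsRoot-actW (reverse V) (∈⇒IsRoot γ∈Δ))) neg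
                  (Pos-cong (≗v-trans (≗v-sym (negv-involutive (s i β)))
                                      (λ j → cong -_ (sym (IsLinear.negv-homo (reflection-linear (simple i)) β j))))
                            sᵢβ-Pos)
        -γ≗Vαᵢ : negv γ ≗v actW V (simple i)
        -γ≗Vαᵢ = ≗v-trans (λ j → cong -_ (sym (actW-actW⁻¹ V γ j)))
                   (≗v-trans (≗v-sym (actW-negv V β)) (actW-cong V -β≗αᵢ))
        Vαᵢ-below : Pos⟨ x ⟩ (actW V (simple i))
        Vαᵢ-below = Pos⟨⟩-cong -γ≗Vαᵢ above

    adapted-from : ∀ k V → misplaced-count V ℕ.< k → ∃ (Adapted x)
    adapted-from (suc k) V bound with all-or-some (λ i → Pos⟨⟩-dichotomy x (IsRoot-actW V (simple-IsRoot i)))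
    ... | inj₁ adapted     = V , adapted
    ... | inj₂ (i , above) = adapted-from k (V ∷ʳ i) (ℕ.<-≤-trans (misplaced-count-∷ʳ V i above) (ℕ.s≤s⁻¹ bound))

    Adapted-exists : ∃ (Adapted x)
    Adapted-exists = adapted-from (suc (misplaced-count [])) [] ℕ.≤-refl

  coroot-comb : (Fin n → ℤ) → Vec n
  coroot-comb d = lincomb (λ k → ℤ→ℚ (d k)) (λ k → simple k ᵛ)

  simple-pairing-integral : ∀ d i → Integral ⟪ simple i , coroot-comb d ⟫
  simple-pairing-integral d i = subst Integral (sym (⟪comb⟫ʳ (λ k → ℤ→ℚ (d k)) (λ k → simple k ᵛ) (simple i)))
    (Integral-∑ _ (λ k → Integral-* (d k , refl) (roots-cryst (simple k) (simple i) (simple-roots k) (simple-roots i))))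

  InQᵛ-s : ∀ i {x} → InQᵛ x → InQᵛ (s i x)
  InQᵛ-s i {x} (d , x≗d) = d′ , λ j → begin
    s i x j                                                             ≡⟨ reflection-congʳ (simple i) x≗d j ⟩
    s i (coroot-comb d) j                                               ≡⟨ reflection-via-coroot (simple i) (coroot-comb d) j ⟩
    coroot-comb d j - ⟪ coroot-comb d , simple i ⟫ * (simple i ᵛ) j     ≡⟨ cong (λ t → coroot-comb d j - t * (simple i ᵛ) j) pairing ⟩
    coroot-comb d j - ℤ→ℚ p * (simple i ᵛ) j                            ≡⟨ sym (comb-update (λ k → ℤ→ℚ (d k)) (ℤ→ℚ p) i (λ k → simple k ᵛ) j) ⟩
    comb (λ k → ℤ→ℚ (d k) - ℤ→ℚ p * ℕ→ℚ (δ i k)) (λ k → simple k ᵛ) j  ≡⟨ ∑-cong (λ k → cong (_* (simple k ᵛ) j) (sym (ℤ→ℚ-update (d k) p (δ i k)))) ⟩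
    coroot-comb d′ j                                                    ∎
    where
    open ≡-Reasoning
    p : ℤ
    p = proj₁ (simple-pairing-integral d i)
    pairing : ⟪ coroot-comb d , simple i ⟫ ≡ ℤ→ℚ p
    pairing = trans (⟪⟫-sym (coroot-comb d) (simple i)) (proj₂ (simple-pairing-integral d i))
    d′ : Fin n → ℤ
    d′ k = d k ℤ.- p ℤ.* ℤ.+ δ i k

  InQᵛ-actW : ∀ w {x} → InQᵛ x → InQᵛ (actW w x)
  InQᵛ-actW []      x∈Q = x∈Q
  InQᵛ-actW (i ∷ w) x∈Q = InQᵛ-s i (InQᵛ-actW w x∈Q)

  -- The affine Weyl group

  actŴ⁻¹-level : ∀ w y k → proj₂ (actŴ⁻¹ w (y , k)) ≡ k + ⟪ y , vr w ⟫
  actŴ⁻¹-level w y k = begin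
    k - ⟪ A , 0v -v r w ⟫   ≡⟨ cong (λ t → k - t) (trans (⟪-⟫ʳ 0v (r w) A) (cong (_- ⟪ A , r w ⟫) (⟪0⟫ʳ A))) ⟩
    k - (0ℚ - ⟪ A , r w ⟫)  ≡⟨ k-[0-a] k ⟪ A , r w ⟫ ⟩
    k + ⟪ A , r w ⟫         ≡⟨ cong (k +_) (actW-adjoint (v w) y (r w)) ⟩
    k + ⟪ y , vr w ⟫        ∎
    where
    open ≡-Reasoning
    A = actW⁻¹ (v w) y
    k-[0-a] : ∀ k a → k - (0ℚ - a) ≡ k + a
    k-[0-a] = solve-∀ ℚ-ring

  actŴ⁻¹-simple : ∀ w i → proj₂ (actŴ⁻¹ w (simple i , 0ℚ)) ≡ ⟪ vr w , simple i ⟫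
  actŴ⁻¹-simple w i = trans (actŴ⁻¹-level w (simple i) 0ℚ) (trans (+-identityˡ _) (⟪⟫-sym (simple i) (vr w)))

  actŴ⁻¹-α₀ : ∀ w θ → proj₂ (actŴ⁻¹ w (0v -v θ , 1ℚ)) ≡ 1ℚ - ⟪ vr w , θ ⟫
  actŴ⁻¹-α₀ w θ = begin
    proj₂ (actŴ⁻¹ w (0v -v θ , 1ℚ))  ≡⟨ actŴ⁻¹-level w (0v -v θ) 1ℚ ⟩
    1ℚ + ⟪ 0v -v θ , vr w ⟫          ≡⟨ cong (1ℚ +_) (trans (⟪-⟫ˡ 0v θ (vr w)) (cong (_- ⟪ θ , vr w ⟫) (⟪0⟫ˡ (vr w)))) ⟩
    1ℚ + (0ℚ - ⟪ θ , vr w ⟫)         ≡⟨ cong (λ t → 1ℚ + (0ℚ - t)) (⟪⟫-sym θ (vr w)) ⟩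
    1ℚ + (0ℚ - ⟪ vr w , θ ⟫)         ≡⟨ cong (1ℚ +_) (0-p≡-p ⟪ vr w , θ ⟫) ⟩
    1ℚ - ⟪ vr w , θ ⟫                ∎
    where open ≡-Reasoning

  simple-level : ∀ w i → ⟪ simple i , r w ⟫ ≡ ⟪ actW (v w) (simple i) , vr w ⟫
  simple-level w i = sym (actW-isometry (v w) (simple i) (r w))

  Dominant⇒Adapted : ∀ w → Dominant w → Adapted (vr w) (v w)
  Dominant⇒Adapted w dom i with dom i
  ... | inj₁ ((_ , pos) , 0-t≡0) =
    inj₂ (trans (sym (simple-level w i)) (-p≡0⇒p≡0 (trans (sym (0-p≡-p _)) 0-t≡0)) , pos)
  ... | inj₂ (_ , m , 0-t≡1+m) =
    inj₁ (subst (_< 0ℚ) (simple-level w i) (0<-p⇒p<0 (subst (0ℚ <_) (trans (sym 0-t≡1+m) (0-p≡-p _)) (ℕ→ℚ-suc-pos m))))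

  Adapted⇒Dominant : ∀ w → Adapted (vr w) (v w) → Dominant w
  Adapted⇒Dominant w adapted i with adapted i
  ... | inj₁ t<0 = inj₂ (actW-roots (v w) (simple-roots i) ,
                         negative-integral (simple-pairing-integral (rco w) i) (subst (_< 0ℚ) (sym (simple-level w i)) t<0))
  ... | inj₂ (t≡0 , pos) = inj₁ ((actW-roots (v w) (simple-roots i) , pos) ,
                                 trans (cong (λ t → 0ℚ - t) (trans (simple-level w i) t≡0)) (+-inverseʳ 0ℚ))

  InDmin-cong : ∀ θ {x y} → x ≗v y → InDmin θ x → InDmin θ y
  InDmin-cong θ e (short , long , highest) =
    (λ i sh → subst (- 1ℚ ≤_) (⟪⟫-congˡ (simple i) e) (short i sh)) ,
    (λ i lg → subst (0ℚ ≤_) (⟪⟫-congˡ (simple i) e) (long i lg)) ,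
    subst (_≤ 1ℚ) (⟪⟫-congˡ θ e) highest

  SMinimal⇔ : ∀ θ w → SMinimal θ w ⇔ (Dominant w × InDmin θ (vr w) × InQᵛ (vr w))
  SMinimal⇔ θ w = mk⇔
    (λ (dom , short , long , α₀) →
       dom ,
       ((λ i sh → subst (- 1ℚ ≤_) (actŴ⁻¹-simple w i) (short i sh)) ,
        (λ i lg → subst (0ℚ ≤_) (actŴ⁻¹-simple w i) (long i lg)) ,
        Equivalence.to (0≤1-p⇔p≤1 ⟪ vr w , θ ⟫) (subst (0ℚ ≤_) (actŴ⁻¹-α₀ w θ) α₀)) ,
       InQᵛ-actW (v w) (rco w , ≗v-refl))
    (λ (dom , (short , long , highest) , _) →
       dom ,
       (λ i sh → subst (- 1ℚ ≤_) (sym (actŴ⁻¹-simple w i)) (short i sh)) ,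
       (λ i lg → subst (0ℚ ≤_) (sym (actŴ⁻¹-simple w i)) (long i lg)) ,
       subst (0ℚ ≤_) (sym (actŴ⁻¹-α₀ w θ)) (Equivalence.from (0≤1-p⇔p≤1 ⟪ vr w , θ ⟫) highest))

  vr-cong : ∀ w w′ → w ≈Ŵ w′ → vr w ≗v vr w′
  vr-cong w w′ w≈w′ = ≗v-trans (proj₁ (w≈w′ (r w , 0ℚ))) (actW-cong (v w′) r≗r′)
    where
    r≗r′ : r w ≗v r w′
    r≗r′ = ⟪⟫-separating λ z → neg-injective (trans (sym (0-p≡-p _)) (trans (proj₂ (w≈w′ (z , 0ℚ))) (0-p≡-p _)))

  Dominant-vr-injective : ∀ w w′ → Dominant w → Dominant w′ → vr w ≗v vr w′ → w ≈Ŵ w′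
  Dominant-vr-injective w w′ dom dom′ vr≗ (y , k) = v≗v′ y , cong (λ t → k - t) (⟪⟫-congʳ y r≗r′)
    where
    v≗v′ : ∀ y → actW (v w) y ≗v actW (v w′) y
    v≗v′ = Adapted-unique (v w) (v w′) (Dominant⇒Adapted w dom) (Adapted-congˣ (v w′) (≗v-sym vr≗) (Dominant⇒Adapted w′ dom′))
    r≗r′ : r w ≗v r w′
    r≗r′ = actW-injective (v w) (≗v-trans vr≗ (≗v-sym (v≗v′ (r w′))))

  SMinimal-vr-surjective : ∀ θ x → InDmin θ x → InQᵛ x → ∃ λ w → SMinimal θ w × vr w ≗v x
  SMinimal-vr-surjective θ x x∈Dmin x∈Q = w , Equivalence.from (SMinimal⇔ θ w) (dominant , x∈Dmin′ , InQᵛ-actW V (d , ≗v-refl)) , vr≗x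
    where
    V = proj₁ (Adapted-exists x)
    d = proj₁ (InQᵛ-actW (reverse V) x∈Q)
    w = V ·t d
    vr≗x : vr w ≗v x
    vr≗x = ≗v-trans (actW-cong V (≗v-sym (proj₂ (InQᵛ-actW (reverse V) x∈Q)))) (actW-actW⁻¹ V x)
    dominant : Dominant w
    dominant = Adapted⇒Dominant w (Adapted-congˣ V (≗v-sym vr≗x) (proj₂ (Adapted-exists x)))
    x∈Dmin′ : InDmin θ (vr w)
    x∈Dmin′ = InDmin-cong θ (≗v-sym vr≗x) x∈Dmin

open RootSystemTheory

proposition5p3 : ∀ {n : ℕ} (R : RootSystem n) (θ : Vec n) →
    RootSystem.IsHighest R θ →
    let open RootSystem R in
    -- (1)
    (∀ (w : Ŵ) → SMinimal θ w ⇔ (Dominant w × InDmin θ (vr w) × InQᵛ (vr w)))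
    -- (2) w = v·t_r ↦ v(r) is a bijection {s-minimal} → D_min ∩ Q^∨
    × (∀ (w w' : Ŵ) → w ≈Ŵ w' → vr w ≗v vr w')
    × (∀ (w w' : Ŵ) → SMinimal θ w → SMinimal θ w' → vr w ≗v vr w' → w ≈Ŵ w')
    × (∀ (x : Vec n) → InDmin θ x → InQᵛ x → ∃ λ (w : Ŵ) → SMinimal θ w × vr w ≗v x)
proposition5p3 R θ _ =
  SMinimal⇔ R θ ,
  vr-cong R ,
  (λ w w′ (dom , _) (dom′ , _) → Dominant-vr-injective R w w′ dom dom′) ,
  SMinimal-vr-surjective R θ
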